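{- Let $s,t\geqslant 0$ be integers with $s+t=n/4$, and let $H$ be a Hadamard matrix of order $n$ whose first four rows are (as concatenations of constant blocks of the indicated lengths, in this column order) $$\begin{array}{rrrrrrrr} \mathbb{1}_s & \mathbb{1}_t & \mathbb{1}_t & \mathbb{1}_s & \mathbb{1}_t & \mathbb{1}_s & \mathbb{1}_s & \mathbb{1}_t \\ \mathbb{1}_s & \mathbb{1}_t & \mathbb{1}_t & \mathbb{1}_s & -\mathbb{1}_t & -\mathbb{1}_s & -\mathbb{1}_s & -\mathbb{1}_t \\ \mathbb{1}_s & \mathbb{1}_t & -\mathbb{1}_t & -\mathbb{1}_s & \mathbb{1}_t & \mathbb{1}_s & -\mathbb{1}_s & -\mathbb{1}_t \\ \mathbb{1}_s & -\mathbb{1}_t & \mathbb{1}_t & -\mathbb{1}_s & \mathbb{1}_t & -\mathbb{1}_s & \mathbb{1}_s & -\mathbb{1}_t \end{array}$$ Let $(h_1,\ldots,h_n)$ be any row of $H$ other than the first four, and define $x_1=\sum_{i=1}^{s}h_i$, $x_2=\sum_{i=s+2t+1}^{2s+2t}h_i$, $x_3=\sum_{i=2s+3t+1}^{3s+3t}h_i$, $x_4=\sum_{i=3s+3t+1}^{4s+3t}h_i$, and $y_1=\sum_{i=s+1}^{s+t}h_i$, $y_2=\sum_{i=s+t+1}^{s+2t}h_i$, $y_3=\sum_{i=2s+2t+1}^{2s+3t}h_i$, $y_4=\sum_{i=4s+3t+1}^{n}h_i$. Then $x_1+x_2+x_3-x_4\equiv 2s-\frac n2\pmod 4$ and $y_1+y_2+y_3-y_4\equiv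 2t-\frac n2\pmod 4$.
   Context: A Hadamard matrix of order $n$ is an $n\times n$ matrix $H$ with entries in $\{ -1,1\}$ and $HH^\top=nI$. $\mathbb{1}_r$ denotes the all-ones row vector of length $r$. -}

module Defs where

open import Data.Nat using (ℕ)
open import Data.Integer using (ℤ; +_; -_; _*_; _+_; _-_)
open import Data.Fin using (Fin)
open import Data.List using (List; foldr; tabulate; replicate; take; drop; _++_)
open import Data.Sum using (_⊎_)
open import Data.Product using (_×_)
open import Relation.Binary.PropositionalEquality using (_≡_; _≢_)

sumℤ : List ℤ → ℤ
sumℤ = foldr _+_ (+ 0)

Matrix : ℕ → Set
Matrix n = Fin n → Fin n → ℤ

row : ∀ {n} → Matrix n → Fin n → List ℤ
row H i = tabulate (H i)

HHᵀ : ∀ {n} → Matrix n → Fin n → Fin n → ℤ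
HHᵀ {n} H i j = sumℤ (tabulate {n = n} (λ k → H i k * H j k))

IsHadamard : (n : ℕ) → Matrix n → Set
IsHadamard n H =
  (∀ i j → (H i j ≡ + 1) ⊎ (H i j ≡ - (+ 1)))
  × (∀ i → HHᵀ H i i ≡ + n)
  × (∀ i j → i ≢ j → HHᵀ H i j ≡ + 0)

blk : ℕ → ℤ → List ℤ
blk r ε = replicate r ε

pattern8 : (s t : ℕ) → (e1 e2 e3 e4 e5 e6 e7 e8 : ℤ) → List ℤ
pattern8 s t e1 e2 e3 e4 e5 e6 e7 e8 =
  blk s e1 ++ blk t e2 ++ blk t e3 ++ blk s e4 ++ blk t e5 ++ blk s e6 ++ blk s e7 ++ blk t e8

p : ℤ
p = + 1

m : ℤ
m = - (+ 1)

row1 row2 row3 row4 : ℕ → ℕ → List ℤ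
row1 s t = pattern8 s t p p p p p p p p
row2 s t = pattern8 s t p p p p m m m m
row3 s t = pattern8 s t p p m m p p m m
row4 s t = pattern8 s t p m p m p m p m

-- Σ_{i=a}^{b} h_i  (1-based, inclusive), written as: skip the first (a-1) entries,
-- then sum the next (b-a+1) entries.  rangeSum k len L = sum of L[k], ..., L[k+len-1] (0-based).
rangeSum : ℕ → ℕ → List ℤ → ℤ
rangeSum k len L = sumℤ (take len (drop k L))

-- Let x₁ y₁ y₂ x₂ y₃ x₃ x₄ y₄ be the sums of the row h over the eight column blocks, in
-- column order (the xᵢ over the blocks of length s, the yᵢ over those of length t).  Since
-- each of the first four rows is constant on every block, orthogonality of h to them says
-- that this vector of block sums is orthogonal to their four sign vectors.  Adding the four
-- relations gives y₁ + y₂ + y₃ - y₄ = -2x₁; adding the last three and subtracting the first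
-- gives x₁ - x₂ - x₃ - x₄ = 2y₄.  A sum of k entries ±1 is ≡ k (mod 2), so twice a block
-- sum is ≡ twice its length (mod 4), and with n/2 = 2(s + t) both congruences follow.

module Submission where

open import Defs
open import Data.Nat using (ℕ; _≤_; _/_) renaming (_+_ to _+ℕ_; _*_ to _*ℕ_)
open import Data.Integer using (ℤ; +_; _+_; _-_; _*_)
open import Data.Integer.Divisibility using (_∣_)
open import Data.Fin using (Fin; toℕ)
open import Data.List using (List)
open import Data.Product using (_×_)
open import Relation.Binary.PropositionalEquality using (_≡_)

open import Function using (_∘_; _$_)
open import Data.Nat using (zero; suc; _<_; z<s; s<s; _⊓_; _∸_)
open import Data.Nat.Properties
  using (suc-injective; +-comm; *-comm; *-assoc; m≤m+n; m+n≤o⇒m≤o∸n; m≤n⇒m⊓n≡m; <-trans; <-≤-trans; <-irrefl)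
open import Data.Nat.DivMod using (m*n/n≡m)
import Data.Nat.Tactic.RingSolver as ℕ-Solver
open import Data.Integer using (-_)
open import Data.Integer.Properties using (+-assoc; +-identityˡ; *-distribʳ-+; *-cancelˡ-≡; pos-+; pos-*)
open import Data.Integer.Divisibility.Signed
  using (divides; ∣⇒∣ᵤ; ∣-refl; ∣m∣n⇒∣m+n; ∣m∣n⇒∣m-n; ∣m⇒∣m*n; *-monoʳ-∣) renaming (_∣_ to _∣ₛ_)
open import Data.Integer.Tactic.RingSolver using (solve-∀)
open import Data.Fin using (zero; suc; fromℕ<)
open import Data.Fin.Properties using (toℕ<n; toℕ-fromℕ<)
open import Data.List using ([]; _∷_; zipWith; tabulate; replicate; take; drop; length; _++_; map)
open import Data.List.Properties using (drop-drop; length-take; length-drop; length-tabulate; ++-identityʳ)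
open import Data.List.Relation.Unary.All using (All; []; _∷_)
open import Data.List.Relation.Unary.All.Properties using (take⁺; drop⁺; tabulate⁺)
open import Data.Product using (_,_)
open import Data.Sum using (_⊎_; inj₁; inj₂)
open import Relation.Binary.PropositionalEquality using (_≢_; refl; sym; trans; cong; cong₂; subst; module ≡-Reasoning)

open ≡-Reasoning

IsSign : ℤ → Set
IsSign x = (x ≡ + 1) ⊎ (x ≡ - (+ 1))

dot : List ℤ → List ℤ → ℤ
dot u v = sumℤ (zipWith _*_ u v)

Orthogonal : List ℤ → List ℤ → Set
Orthogonal u v = dot u v ≡ + 0

infixr 6 _⊕_

_⊕_ : List ℤ → List ℤ → List ℤ
u ⊕ v = zipWith _+_ u v

dot-[]ʳ : ∀ u → dot u [] ≡ + 0
dot-[]ʳ []      = refl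
dot-[]ʳ (_ ∷ _) = refl

dot-⊕ʳ : ∀ a u v → length u ≡ length v → dot a (u ⊕ v) ≡ dot a u + dot a v
dot-⊕ʳ []      u       v       _   = refl
dot-⊕ʳ (x ∷ a) []      []      _   = refl
dot-⊕ʳ (x ∷ a) (y ∷ u) (z ∷ v) |u|≡|v| = begin
  x * (y + z) + dot a (u ⊕ v)            ≡⟨ cong (_+_ (x * (y + z))) (dot-⊕ʳ a u v (suc-injective |u|≡|v|)) ⟩
  x * (y + z) + (dot a u + dot a v)      ≡⟨ regroup x y z (dot a u) (dot a v) ⟩
  (x * y + dot a u) + (x * z + dot a v)  ∎
  where
  regroup : ∀ x y z d e → x * (y + z) + (d + e) ≡ (x * y + d) + (x * z + e)
  regroup = solve-∀

dot-map-negʳ : ∀ a u → dot a (map -_ u) ≡ - dot a u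
dot-map-negʳ []      u       = refl
dot-map-negʳ (x ∷ a) []      = refl
dot-map-negʳ (x ∷ a) (y ∷ u) = begin
  x * - y + dot a (map -_ u)  ≡⟨ cong (_+_ (x * - y)) (dot-map-negʳ a u) ⟩
  x * - y + - dot a u         ≡⟨ regroup x y (dot a u) ⟩
  - (x * y + dot a u)         ∎
  where
  regroup : ∀ x y d → x * - y + - d ≡ - (x * y + d)
  regroup = solve-∀

⊥-⊕ʳ : ∀ a u v → length u ≡ length v → Orthogonal a u → Orthogonal a v → Orthogonal a (u ⊕ v)
⊥-⊕ʳ a u v |u|≡|v| a⊥u a⊥v = trans (dot-⊕ʳ a u v |u|≡|v|) (cong₂ _+_ a⊥u a⊥v)

⊥-map-negʳ : ∀ a u → Orthogonal a u → Orthogonal a (map -_ u)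
⊥-map-negʳ a u a⊥u = trans (dot-map-negʳ a u) (cong -_ a⊥u)

dot-replicate-++ : ∀ k e u v → dot u (replicate k e ++ v) ≡ sumℤ (take k u) * e + dot (drop k u) v
dot-replicate-++ zero    e u       v = sym (+-identityˡ (dot u v))
dot-replicate-++ (suc k) e []      v = refl
dot-replicate-++ (suc k) e (x ∷ u) v = begin
  x * e + dot u (replicate k e ++ v)                     ≡⟨ cong (_+_ (x * e)) (dot-replicate-++ k e u v) ⟩
  x * e + (sumℤ (take k u) * e + dot (drop k u) v)       ≡⟨ sym (+-assoc (x * e) _ _) ⟩
  x * e + sumℤ (take k u) * e + dot (drop k u) v         ≡⟨ cong (_+ dot (drop k u) v) (sym (*-distribʳ-+ e x _)) ⟩
  (x + sumℤ (take k u)) * e + dot (drop k u) v           ∎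

zipWith-tabulate : ∀ {A B C : Set} {n} (f : A → B → C) (g : Fin n → A) (h : Fin n → B) →
                   zipWith f (tabulate g) (tabulate h) ≡ tabulate (λ i → f (g i) (h i))
zipWith-tabulate {n = zero}  f g h = refl
zipWith-tabulate {n = suc n} f g h = cong (f (g zero) (h zero) ∷_) (zipWith-tabulate f (g ∘ suc) (h ∘ suc))

HHᵀ≡dot-rows : ∀ {n} (H : Matrix n) i j → HHᵀ H i j ≡ dot (row H i) (row H j)
HHᵀ≡dot-rows H i j = cong sumℤ (sym (zipWith-tabulate _*_ (H i) (H j)))

row-signs : ∀ {n H} → IsHadamard n H → ∀ r → All IsSign (row H r)
row-signs (±1 , _) r = tabulate⁺ (±1 r)

orthogonal-to-row : ∀ {n H} → IsHadamard n H → ∀ {k v} → (∀ i → toℕ i ≡ k → row H i ≡ v) →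
                    ∀ {r} → k < toℕ r → Orthogonal (row H r) v
orthogonal-to-row {n} {H} (_ , _ , orthogonal) {k} {v} row-k≡v {r} k<r = begin
  dot (row H r) v          ≡⟨ cong (dot (row H r)) (sym (row-k≡v i (toℕ-fromℕ< k<n))) ⟩
  dot (row H r) (row H i)  ≡⟨ sym (HHᵀ≡dot-rows H r i) ⟩
  HHᵀ H r i                ≡⟨ orthogonal r i r≢i ⟩
  + 0                      ∎
  where
  k<n : k < n
  k<n = <-trans k<r (toℕ<n r)
  i : Fin n
  i = fromℕ< k<n
  r≢i : r ≢ i
  r≢i r≡i = <-irrefl (sym (trans (cong toℕ r≡i) (toℕ-fromℕ< k<n))) k<r

sign-parity : ∀ {x} → IsSign x → + 2 ∣ₛ x - + 1
sign-parity (inj₁ refl) = divides (+ 0) refl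
sign-parity (inj₂ refl) = divides (- + 1) refl

sum-parity : ∀ {u} → All IsSign u → + 2 ∣ₛ sumℤ u - + length u
sum-parity []                   = divides (+ 0) refl
sum-parity {x ∷ u} (±x ∷ ±u) =
  subst (+ 2 ∣ₛ_) (regroup x (sumℤ u) (+ length u)) (∣m∣n⇒∣m+n (sign-parity ±x) (sum-parity ±u))
  where
  regroup : ∀ x s l → (x - + 1) + (s - l) ≡ x + s - (+ 1 + l)
  regroup = solve-∀

rangeSum-parity : ∀ {u} k len → All IsSign u → k +ℕ len ≤ length u → + 2 ∣ₛ rangeSum k len u - + len
rangeSum-parity {u} k len ±u k+len≤|u| =
  subst (λ l → + 2 ∣ₛ rangeSum k len u - + l) |block|≡len (sum-parity (take⁺ len (drop⁺ k ±u)))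
  where
  |block|≡len : length (take len (drop k u)) ≡ len
  |block|≡len = begin
    length (take len (drop k u))  ≡⟨ length-take len (drop k u) ⟩
    len ⊓ length (drop k u)       ≡⟨ cong (len ⊓_) (length-drop k u) ⟩
    len ⊓ (length u ∸ k)          ≡⟨ m≤n⇒m⊓n≡m (m+n≤o⇒m≤o∸n len (subst (_≤ length u) (+-comm k len) k+len≤|u|)) ⟩
    len                           ∎

dot-drop-blk-++ : ∀ u {k k′} len e v → k +ℕ len ≡ k′ →
                  dot (drop k u) (blk len e ++ v) ≡ rangeSum k len u * e + dot (drop k′ u) v
dot-drop-blk-++ u {k} len e v refl =
  trans (dot-replicate-++ len e (drop k u) v) (cong (λ w → rangeSum k len u * e + dot w v) (drop-drop k len u))

module Blocks (s t : ℕ) (h : List ℤ) where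

  private
    s+t+t≡s+2t : ∀ s t → s +ℕ t +ℕ t ≡ s +ℕ 2 *ℕ t
    s+t+t≡s+2t = ℕ-Solver.solve-∀

    s+2t+s≡2s+2t : ∀ s t → s +ℕ 2 *ℕ t +ℕ s ≡ 2 *ℕ s +ℕ 2 *ℕ t
    s+2t+s≡2s+2t = ℕ-Solver.solve-∀

    2s+2t+t≡2s+3t : ∀ s t → 2 *ℕ s +ℕ 2 *ℕ t +ℕ t ≡ 2 *ℕ s +ℕ 3 *ℕ t
    2s+2t+t≡2s+3t = ℕ-Solver.solve-∀

    2s+3t+s≡3s+3t : ∀ s t → 2 *ℕ s +ℕ 3 *ℕ t +ℕ s ≡ 3 *ℕ s +ℕ 3 *ℕ t
    2s+3t+s≡3s+3t = ℕ-Solver.solve-∀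

    3s+3t+s≡4s+3t : ∀ s t → 3 *ℕ s +ℕ 3 *ℕ t +ℕ s ≡ 4 *ℕ s +ℕ 3 *ℕ t
    3s+3t+s≡4s+3t = ℕ-Solver.solve-∀

    s+[3s+4t]≡4[s+t] : ∀ s t → s +ℕ (3 *ℕ s +ℕ 4 *ℕ t) ≡ 4 *ℕ (s +ℕ t)
    s+[3s+4t]≡4[s+t] = ℕ-Solver.solve-∀

    s+2t+s+[2s+2t]≡4[s+t] : ∀ s t → s +ℕ 2 *ℕ t +ℕ s +ℕ (2 *ℕ s +ℕ 2 *ℕ t) ≡ 4 *ℕ (s +ℕ t)
    s+2t+s+[2s+2t]≡4[s+t] = ℕ-Solver.solve-∀

    2s+3t+s+[s+t]≡4[s+t] : ∀ s t → 2 *ℕ s +ℕ 3 *ℕ t +ℕ s +ℕ (s +ℕ t) ≡ 4 *ℕ (s +ℕ t)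
    2s+3t+s+[s+t]≡4[s+t] = ℕ-Solver.solve-∀

    4s+3t+t+0≡4[s+t] : ∀ s t → 4 *ℕ s +ℕ 3 *ℕ t +ℕ t +ℕ 0 ≡ 4 *ℕ (s +ℕ t)
    4s+3t+t+0≡4[s+t] = ℕ-Solver.solve-∀

  x₁ x₂ x₃ x₄ y₁ y₂ y₃ y₄ : ℤ
  x₁ = rangeSum 0 s h
  y₁ = rangeSum s t h
  y₂ = rangeSum (s +ℕ t) t h
  x₂ = rangeSum (s +ℕ 2 *ℕ t) s h
  y₃ = rangeSum (2 *ℕ s +ℕ 2 *ℕ t) t h
  x₃ = rangeSum (2 *ℕ s +ℕ 3 *ℕ t) s h
  x₄ = rangeSum (3 *ℕ s +ℕ 3 *ℕ t) s h
  y₄ = rangeSum (4 *ℕ s +ℕ 3 *ℕ t) t h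

  blockSums : List ℤ
  blockSums = x₁ ∷ y₁ ∷ y₂ ∷ x₂ ∷ y₃ ∷ x₃ ∷ x₄ ∷ y₄ ∷ []

  dot-pattern8 : ∀ e₁ e₂ e₃ e₄ e₅ e₆ e₇ e₈ →
    dot h (pattern8 s t e₁ e₂ e₃ e₄ e₅ e₆ e₇ e₈) ≡ dot blockSums (e₁ ∷ e₂ ∷ e₃ ∷ e₄ ∷ e₅ ∷ e₆ ∷ e₇ ∷ e₈ ∷ [])
  dot-pattern8 e₁ e₂ e₃ e₄ e₅ e₆ e₇ e₈ =
    block 0                     s refl                  $
    block s                     t refl                  $
    block (s +ℕ t)              t (s+t+t≡s+2t s t)      $
    block (s +ℕ 2 *ℕ t)         s (s+2t+s≡2s+2t s t)    $
    block (2 *ℕ s +ℕ 2 *ℕ t)    t (2s+2t+t≡2s+3t s t)   $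
    block (2 *ℕ s +ℕ 3 *ℕ t)    s (2s+3t+s≡3s+3t s t)   $
    block (3 *ℕ s +ℕ 3 *ℕ t)    s (3s+3t+s≡4s+3t s t)   $
    last
    where
    block : ∀ k len {k′ e v d} → k +ℕ len ≡ k′ → dot (drop k′ h) v ≡ d →
            dot (drop k h) (blk len e ++ v) ≡ rangeSum k len h * e + d
    block k len {e = e} {v} k+len≡k′ rest =
      trans (dot-drop-blk-++ h len e v k+len≡k′) (cong (_+_ (rangeSum k len h * e)) rest)
    last : dot (drop (4 *ℕ s +ℕ 3 *ℕ t) h) (blk t e₈) ≡ y₄ * e₈ + + 0
    last = subst (λ v → dot (drop (4 *ℕ s +ℕ 3 *ℕ t) h) v ≡ y₄ * e₈ + + 0) (++-identityʳ (blk t e₈))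
                 (block (4 *ℕ s +ℕ 3 *ℕ t) t refl (dot-[]ʳ (drop (4 *ℕ s +ℕ 3 *ℕ t +ℕ t) h)))

  blockSums-orthogonal : ∀ {e₁ e₂ e₃ e₄ e₅ e₆ e₇ e₈} → Orthogonal h (pattern8 s t e₁ e₂ e₃ e₄ e₅ e₆ e₇ e₈) →
                         Orthogonal blockSums (e₁ ∷ e₂ ∷ e₃ ∷ e₄ ∷ e₅ ∷ e₆ ∷ e₇ ∷ e₈ ∷ [])
  blockSums-orthogonal h⊥ = trans (sym (dot-pattern8 _ _ _ _ _ _ _ _)) h⊥

  module Parities (±h : All IsSign h) (|h|≡4[s+t] : length h ≡ 4 *ℕ (s +ℕ t)) where

    private
      parity : ∀ k len rest → k +ℕ len +ℕ rest ≡ 4 *ℕ (s +ℕ t) → + 2 ∣ₛ rangeSum k len h - + len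
      parity k len rest k+len+rest≡4[s+t] =
        rangeSum-parity k len ±h (subst (k +ℕ len ≤_) (trans k+len+rest≡4[s+t] (sym |h|≡4[s+t])) (m≤m+n _ rest))

    x₁-parity : + 2 ∣ₛ x₁ - + s
    x₁-parity = parity 0 s (3 *ℕ s +ℕ 4 *ℕ t) (s+[3s+4t]≡4[s+t] s t)

    x₂-parity : + 2 ∣ₛ x₂ - + s
    x₂-parity = parity (s +ℕ 2 *ℕ t) s (2 *ℕ s +ℕ 2 *ℕ t) (s+2t+s+[2s+2t]≡4[s+t] s t)

    x₃-parity : + 2 ∣ₛ x₃ - + s
    x₃-parity = parity (2 *ℕ s +ℕ 3 *ℕ t) s (s +ℕ t) (2s+3t+s+[s+t]≡4[s+t] s t)

    y₄-parity : + 2 ∣ₛ y₄ - + t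
    y₄-parity = parity (4 *ℕ s +ℕ 3 *ℕ t) t 0 (4s+3t+t+0≡4[s+t] s t)

signs₁ signs₂ signs₃ signs₄ : List ℤ
signs₁ = p ∷ p ∷ p ∷ p ∷ p ∷ p ∷ p ∷ p ∷ []
signs₂ = p ∷ p ∷ p ∷ p ∷ m ∷ m ∷ m ∷ m ∷ []
signs₃ = p ∷ p ∷ m ∷ m ∷ p ∷ p ∷ m ∷ m ∷ []
signs₄ = p ∷ m ∷ p ∷ m ∷ p ∷ m ∷ p ∷ m ∷ []

-- The right-hand side of each `expand` is the normal form of the `dot` in the type of
-- `a⊥sum`, so the `trans` of the two is accepted by evaluation.
module BlockRelations (x₁ x₂ x₃ x₄ y₁ y₂ y₃ y₄ : ℤ) where

  private
    a : List ℤ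
    a = x₁ ∷ y₁ ∷ y₂ ∷ x₂ ∷ y₃ ∷ x₃ ∷ x₄ ∷ y₄ ∷ []

  module _ (⊥₁ : Orthogonal a signs₁) (⊥₂ : Orthogonal a signs₂)
           (⊥₃ : Orthogonal a signs₃) (⊥₄ : Orthogonal a signs₄) where

    y-relation : y₁ + y₂ + y₃ - y₄ + + 2 * x₁ ≡ + 0
    y-relation = *-cancelˡ-≡ (+ 2) _ (+ 0) (trans (expand x₁ x₂ x₃ x₄ y₁ y₂ y₃ y₄) a⊥sum)
      where
      a⊥sum : Orthogonal a (signs₁ ⊕ signs₂ ⊕ signs₃ ⊕ signs₄)
      a⊥sum = ⊥-⊕ʳ a signs₁ (signs₂ ⊕ signs₃ ⊕ signs₄) refl ⊥₁
                (⊥-⊕ʳ a signs₂ (signs₃ ⊕ signs₄) refl ⊥₂ (⊥-⊕ʳ a signs₃ signs₄ refl ⊥₃ ⊥₄))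
      expand : ∀ x₁ x₂ x₃ x₄ y₁ y₂ y₃ y₄ → + 2 * (y₁ + y₂ + y₃ - y₄ + + 2 * x₁) ≡
               x₁ * + 4 + (y₁ * + 2 + (y₂ * + 2 + (x₂ * + 0 + (y₃ * + 2 + (x₃ * + 0 + (x₄ * + 0 + (y₄ * - + 2 + + 0)))))))
      expand = solve-∀

    x-relation : x₁ - x₂ - x₃ - x₄ - + 2 * y₄ ≡ + 0
    x-relation = *-cancelˡ-≡ (+ 2) _ (+ 0) (trans (expand x₁ x₂ x₃ x₄ y₁ y₂ y₃ y₄) a⊥sum)
      where
      a⊥sum : Orthogonal a (map -_ signs₁ ⊕ signs₂ ⊕ signs₃ ⊕ signs₄)
      a⊥sum = ⊥-⊕ʳ a (map -_ signs₁) (signs₂ ⊕ signs₃ ⊕ signs₄) refl (⊥-map-negʳ a signs₁ ⊥₁)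
                (⊥-⊕ʳ a signs₂ (signs₃ ⊕ signs₄) refl ⊥₂ (⊥-⊕ʳ a signs₃ signs₄ refl ⊥₃ ⊥₄))
      expand : ∀ x₁ x₂ x₃ x₄ y₁ y₂ y₃ y₄ → + 2 * (x₁ - x₂ - x₃ - x₄ - + 2 * y₄) ≡
               x₁ * + 2 + (y₁ * + 0 + (y₂ * + 0 + (x₂ * - + 2 + (y₃ * + 0 + (x₃ * - + 2 + (x₄ * - + 2 + (y₄ * - + 4 + + 0)))))))
      expand = solve-∀

    y-congruence : ∀ {σ τ ν} → ν ≡ + 2 * (σ + τ) → + 2 ∣ₛ x₁ - σ →
                   + 4 ∣ₛ (y₁ + y₂ + y₃ - y₄) - (+ 2 * τ - ν)
    y-congruence {σ} {τ} refl 2∣x₁-σ =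
      subst (+ 4 ∣ₛ_) (regroup x₁ y₁ y₂ y₃ y₄ σ τ)
        (∣m∣n⇒∣m-n (divides (+ 0) y-relation) (*-monoʳ-∣ (+ 2) 2∣x₁-σ))
      where
      regroup : ∀ x₁ y₁ y₂ y₃ y₄ σ τ → (y₁ + y₂ + y₃ - y₄ + + 2 * x₁) - + 2 * (x₁ - σ) ≡
                                        (y₁ + y₂ + y₃ - y₄) - (+ 2 * τ - + 2 * (σ + τ))
      regroup = solve-∀

    x-congruence : ∀ {σ τ ν} → ν ≡ + 2 * (σ + τ) → + 2 ∣ₛ x₂ - σ → + 2 ∣ₛ x₃ - σ → + 2 ∣ₛ y₄ - τ →
                   + 4 ∣ₛ (x₁ + x₂ + x₃ - x₄) - (+ 2 * σ - ν)
    x-congruence {σ} {τ} refl 2∣x₂-σ 2∣x₃-σ 2∣y₄-τ =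
      subst (+ 4 ∣ₛ_) (regroup x₁ x₂ x₃ x₄ y₄ σ τ)
        (∣m∣n⇒∣m+n (∣m∣n⇒∣m+n (∣m∣n⇒∣m+n (∣m∣n⇒∣m+n (divides (+ 0) x-relation)
          (*-monoʳ-∣ (+ 2) 2∣x₂-σ)) (*-monoʳ-∣ (+ 2) 2∣x₃-σ)) (*-monoʳ-∣ (+ 2) 2∣y₄-τ)) (∣m⇒∣m*n (σ + τ) ∣-refl))
      where
      regroup : ∀ x₁ x₂ x₃ x₄ y₄ σ τ →
                (x₁ - x₂ - x₃ - x₄ - + 2 * y₄) + + 2 * (x₂ - σ) + + 2 * (x₃ - σ) + + 2 * (y₄ - τ) + + 4 * (σ + τ) ≡
                (x₁ + x₂ + x₃ - x₄) - (+ 2 * σ - + 2 * (σ + τ))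
      regroup = solve-∀

4[s+t]/2≡2[s+t] : ∀ s t → + (4 *ℕ (s +ℕ t) / 2) ≡ + 2 * (+ s + + t)
4[s+t]/2≡2[s+t] s t = begin
  + (4 *ℕ (s +ℕ t) / 2)            ≡⟨ cong (λ k → + (k / 2)) (trans (*-assoc 2 2 (s +ℕ t)) (*-comm 2 (2 *ℕ (s +ℕ t)))) ⟩
  + (2 *ℕ (s +ℕ t) *ℕ 2 / 2)       ≡⟨ cong +_ (m*n/n≡m (2 *ℕ (s +ℕ t)) 2) ⟩
  + (2 *ℕ (s +ℕ t))                ≡⟨ pos-* 2 (s +ℕ t) ⟩
  + 2 * + (s +ℕ t)                 ≡⟨ cong (+ 2 *_) (pos-+ s t) ⟩
  + 2 * (+ s + + t)                ∎

lemma2p9 : (n s t : ℕ) → 4 *ℕ (s +ℕ t) ≡ n → (H : Matrix n) → IsHadamard n H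
  → (∀ (i : Fin n) → toℕ i ≡ 0 → row H i ≡ row1 s t)
  → (∀ (i : Fin n) → toℕ i ≡ 1 → row H i ≡ row2 s t)
  → (∀ (i : Fin n) → toℕ i ≡ 2 → row H i ≡ row3 s t)
  → (∀ (i : Fin n) → toℕ i ≡ 3 → row H i ≡ row4 s t)
  → (r : Fin n) → 4 ≤ toℕ r
  → let h = row H r
        x1 = rangeSum 0 s h
        x2 = rangeSum (s +ℕ 2 *ℕ t) s h
        x3 = rangeSum (2 *ℕ s +ℕ 3 *ℕ t) s h
        x4 = rangeSum (3 *ℕ s +ℕ 3 *ℕ t) s h
        y1 = rangeSum s t h
        y2 = rangeSum (s +ℕ t) t h
        y3 = rangeSum (2 *ℕ s +ℕ 2 *ℕ t) t h
        y4 = rangeSum (4 *ℕ s +ℕ 3 *ℕ t) t h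
    in ((+ 4) ∣ ((x1 + x2 + x3 - x4) - ((+ 2) * (+ s) - + (n / 2))))
     × ((+ 4) ∣ ((y1 + y2 + y3 - y4) - ((+ 2) * (+ t) - + (n / 2))))
lemma2p9 .(4 *ℕ (s +ℕ t)) s t refl H hadamard row₀ row₁ row₂ row₃ r 4≤r =
  ∣⇒∣ᵤ (x-congruence ⊥₁ ⊥₂ ⊥₃ ⊥₄ (4[s+t]/2≡2[s+t] s t) x₂-parity x₃-parity y₄-parity) ,
  ∣⇒∣ᵤ (y-congruence ⊥₁ ⊥₂ ⊥₃ ⊥₄ {τ = + t} (4[s+t]/2≡2[s+t] s t) x₁-parity)
  where
  open Blocks s t (row H r)
  open Parities (row-signs hadamard r) (length-tabulate (H r))
  open BlockRelations x₁ x₂ x₃ x₄ y₁ y₂ y₃ y₄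

  orthogonal-to-first-rows : ∀ {k v} → k < 4 → (∀ i → toℕ i ≡ k → row H i ≡ v) → Orthogonal (row H r) v
  orthogonal-to-first-rows k<4 row-k≡v = orthogonal-to-row hadamard row-k≡v (<-≤-trans k<4 4≤r)

  ⊥₁ : Orthogonal blockSums signs₁
  ⊥₁ = blockSums-orthogonal (orthogonal-to-first-rows z<s row₀)
  ⊥₂ : Orthogonal blockSums signs₂
  ⊥₂ = blockSums-orthogonal (orthogonal-to-first-rows (s<s z<s) row₁)
  ⊥₃ : Orthogonal blockSums signs₃
  ⊥₃ = blockSums-orthogonal (orthogonal-to-first-rows (s<s (s<s z<s)) row₂)
  ⊥₄ : Orthogonal blockSums signs₄
  ⊥₄ = blockSums-orthogonal (orthogonal-to-first-rows (s<s (s<s (s<s z<s))) row₃)
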